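{- For every purely existential $\mathcal{L}^-_{BT}$-sentence $\phi$: if $\mathfrak{B}^-\models\phi$, then $B^-\vdash\phi$.
   Context: Bit strings are elements of $\{\mathbf{0},\mathbf{1}\}^*$; $\varepsilon$ is the empty string. The language $\mathcal{L}^-_{BT}$ has constant symbols $e,0,1$ and a binary function symbol $\circ$ (also written as juxtaposition). The structure $\mathfrak{B}^-$ has universe $\{\mathbf{0},\mathbf{1}\}^*$ and interprets $e,0,1$ as $\varepsilon,\mathbf{0},\mathbf{1}$ and $\circ$ as concatenation. A purely existential $\mathcal{L}^-_{BT}$-formula is one built from equations $s=t$ and negated equations $\neg s=t$ (terms $s,t$) using $\wedge$, $\vee$ and unbounded existential quantifiers $\exists x$. The theory $B^-$ has the four axioms: (1) $\forall x[x=ex\wedge x=xe]$; (2) $\forall xyz[(xy)z=x(yz)]$; (3) $\forall xy[x\neq y\to(x0\neq y0\wedge x1\neq y1)]$; (4) $\forall xy[x0\neq y1]$. -}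

module Defs where

open import Data.Nat using (ℕ; zero; suc)
open import Data.Fin using (Fin; zero; suc)
open import Data.Bool using (Bool; true; false)
open import Data.List using (List; []; _∷_; _++_; map)
open import Data.List.Membership.Propositional using (_∈_)
open import Data.Product using (Σ; _×_)
open import Data.Sum using (_⊎_)
open import Relation.Binary.PropositionalEquality using (_≡_)
open import Relation.Nullary using (¬_)

-- Syntax of the language L⁻_BT (de Bruijn variables; n = number of
-- free variables in scope).

data Term (n : ℕ) : Set where
  var  : Fin n → Term n
  `e   : Term n
  `0   : Term n
  `1   : Term n
  _∙_  : Term n → Term n → Term n

infixl 7 _∙_

data Fm (n : ℕ) : Set where
  _≐_  : Term n → Term n → Fm n
  ⊥'   : Fm n
  _⇒_  : Fm n → Fm n → Fm n
  _∧'_ : Fm n → Fm n → Fm n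
  _∨'_ : Fm n → Fm n → Fm n
  ∀'   : Fm (suc n) → Fm n
  ∃'   : Fm (suc n) → Fm n

infix  5 _≐_
infixr 4 _∧'_
infixr 3 _∨'_
infixr 2 _⇒_

¬' : ∀ {n} → Fm n → Fm n
¬' φ = φ ⇒ ⊥'

Ren : ℕ → ℕ → Set
Ren m n = Fin m → Fin n

ext : ∀ {m n} → Ren m n → Ren (suc m) (suc n)
ext ρ zero    = zero
ext ρ (suc i) = suc (ρ i)

renT : ∀ {m n} → Ren m n → Term m → Term n
renT ρ (var i) = var (ρ i)
renT ρ `e      = `e
renT ρ `0      = `0
renT ρ `1      = `1
renT ρ (s ∙ t) = renT ρ s ∙ renT ρ t

renF : ∀ {m n} → Ren m n → Fm m → Fm n
renF ρ (s ≐ t)  = renT ρ s ≐ renT ρ t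
renF ρ ⊥'       = ⊥'
renF ρ (φ ⇒ ψ)  = renF ρ φ ⇒ renF ρ ψ
renF ρ (φ ∧' ψ) = renF ρ φ ∧' renF ρ ψ
renF ρ (φ ∨' ψ) = renF ρ φ ∨' renF ρ ψ
renF ρ (∀' φ)   = ∀' (renF (ext ρ) φ)
renF ρ (∃' φ)   = ∃' (renF (ext ρ) φ)

Sub : ℕ → ℕ → Set
Sub m n = Fin m → Term n

exts : ∀ {m n} → Sub m n → Sub (suc m) (suc n)
exts σ zero    = var zero
exts σ (suc i) = renT suc (σ i)

subT : ∀ {m n} → Sub m n → Term m → Term n
subT σ (var i) = σ i
subT σ `e      = `e
subT σ `0      = `0
subT σ `1      = `1
subT σ (s ∙ t) = subT σ s ∙ subT σ t

subF : ∀ {m n} → Sub m n → Fm m → Fm n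
subF σ (s ≐ t)  = subT σ s ≐ subT σ t
subF σ ⊥'       = ⊥'
subF σ (φ ⇒ ψ)  = subF σ φ ⇒ subF σ ψ
subF σ (φ ∧' ψ) = subF σ φ ∧' subF σ ψ
subF σ (φ ∨' ψ) = subF σ φ ∨' subF σ ψ
subF σ (∀' φ)   = ∀' (subF (exts σ) φ)
subF σ (∃' φ)   = ∃' (subF (exts σ) φ)

single : ∀ {n} → Term n → Sub (suc n) n
single t zero    = t
single t (suc i) = var i

_[_] : ∀ {n} → Fm (suc n) → Term n → Fm n
φ [ t ] = subF (single t) φ

infix 1 _⊢_

data _⊢_ : {n : ℕ} → List (Fm n) → Fm n → Set where
  hyp   : ∀ {n} {Γ : List (Fm n)} {φ} → φ ∈ Γ → Γ ⊢ φ
  ⇒I    : ∀ {n} {Γ : List (Fm n)} {φ ψ} → (φ ∷ Γ) ⊢ ψ → Γ ⊢ φ ⇒ ψ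
  ⇒E    : ∀ {n} {Γ : List (Fm n)} {φ ψ} → Γ ⊢ φ ⇒ ψ → Γ ⊢ φ → Γ ⊢ ψ
  ∧I    : ∀ {n} {Γ : List (Fm n)} {φ ψ} → Γ ⊢ φ → Γ ⊢ ψ → Γ ⊢ φ ∧' ψ
  ∧E₁   : ∀ {n} {Γ : List (Fm n)} {φ ψ} → Γ ⊢ φ ∧' ψ → Γ ⊢ φ
  ∧E₂   : ∀ {n} {Γ : List (Fm n)} {φ ψ} → Γ ⊢ φ ∧' ψ → Γ ⊢ ψ
  ∨I₁   : ∀ {n} {Γ : List (Fm n)} {φ ψ} → Γ ⊢ φ → Γ ⊢ φ ∨' ψ
  ∨I₂   : ∀ {n} {Γ : List (Fm n)} {φ ψ} → Γ ⊢ ψ → Γ ⊢ φ ∨' ψ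
  ∨E    : ∀ {n} {Γ : List (Fm n)} {φ ψ χ} →
          Γ ⊢ φ ∨' ψ → (φ ∷ Γ) ⊢ χ → (ψ ∷ Γ) ⊢ χ → Γ ⊢ χ
  ⊥E    : ∀ {n} {Γ : List (Fm n)} {φ} → Γ ⊢ ⊥' → Γ ⊢ φ
  raa   : ∀ {n} {Γ : List (Fm n)} {φ} → (¬' φ ∷ Γ) ⊢ ⊥' → Γ ⊢ φ
  ∀I    : ∀ {n} {Γ : List (Fm n)} {φ : Fm (suc n)} →
          map (renF suc) Γ ⊢ φ → Γ ⊢ ∀' φ
  ∀E    : ∀ {n} {Γ : List (Fm n)} {φ : Fm (suc n)} →
          Γ ⊢ ∀' φ → (t : Term n) → Γ ⊢ φ [ t ]
  ∃I    : ∀ {n} {Γ : List (Fm n)} {φ : Fm (suc n)} →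
          (t : Term n) → Γ ⊢ φ [ t ] → Γ ⊢ ∃' φ
  ∃E    : ∀ {n} {Γ : List (Fm n)} {φ : Fm (suc n)} {ψ : Fm n} →
          Γ ⊢ ∃' φ → (φ ∷ map (renF suc) Γ) ⊢ renF suc ψ → Γ ⊢ ψ
  ≐refl : ∀ {n} {Γ : List (Fm n)} {t : Term n} → Γ ⊢ t ≐ t
  ≐subst : ∀ {n} {Γ : List (Fm n)} (φ : Fm (suc n)) {s t : Term n} →
          Γ ⊢ s ≐ t → Γ ⊢ φ [ s ] → Γ ⊢ φ [ t ]

-- The theory B⁻ (closed formulas; variables in de Bruijn notation,
-- the innermost quantifier binds var zero).

private
  v0 : ∀ {n} → Term (suc n)
  v0 = var zero
  v1 : ∀ {n} → Term (suc (suc n))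
  v1 = var (suc zero)
  v2 : ∀ {n} → Term (suc (suc (suc n)))
  v2 = var (suc (suc zero))

axB1 : Fm 0
axB1 = ∀' ((v0 ≐ `e ∙ v0) ∧' (v0 ≐ v0 ∙ `e))

axB2 : Fm 0
axB2 = ∀' (∀' (∀' ((v2 ∙ v1) ∙ v0 ≐ v2 ∙ (v1 ∙ v0))))

axB3 : Fm 0
axB3 = ∀' (∀' (¬' (v1 ≐ v0) ⇒ (¬' (v1 ∙ `0 ≐ v0 ∙ `0) ∧' ¬' (v1 ∙ `1 ≐ v0 ∙ `1))))

axB4 : Fm 0
axB4 = ∀' (∀' (¬' (v1 ∙ `0 ≐ v0 ∙ `1)))

B⁻ : List (Fm 0)
B⁻ = axB1 ∷ axB2 ∷ axB3 ∷ axB4 ∷ []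


data PE (n : ℕ) : Set where
  eqₚ  : Term n → Term n → PE n
  neqₚ : Term n → Term n → PE n
  andₚ : PE n → PE n → PE n
  orₚ  : PE n → PE n → PE n
  exₚ  : PE (suc n) → PE n

⌜_⌝ : ∀ {n} → PE n → Fm n
⌜ eqₚ s t  ⌝ = s ≐ t
⌜ neqₚ s t ⌝ = ¬' (s ≐ t)
⌜ andₚ φ ψ ⌝ = ⌜ φ ⌝ ∧' ⌜ ψ ⌝
⌜ orₚ φ ψ  ⌝ = ⌜ φ ⌝ ∨' ⌜ ψ ⌝
⌜ exₚ φ    ⌝ = ∃' ⌜ φ ⌝

BitString : Set
BitString = List Bool

Env : ℕ → Set
Env n = Fin n → BitString

_,,_ : ∀ {n} → Env n → BitString → Env (suc n)
(ρ ,, w) zero    = w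
(ρ ,, w) (suc i) = ρ i

⟦_⟧ₜ : ∀ {n} → Term n → Env n → BitString
⟦ var i ⟧ₜ ρ = ρ i
⟦ `e    ⟧ₜ ρ = []
⟦ `0    ⟧ₜ ρ = false ∷ []
⟦ `1    ⟧ₜ ρ = true ∷ []
⟦ s ∙ t ⟧ₜ ρ = ⟦ s ⟧ₜ ρ ++ ⟦ t ⟧ₜ ρ

_⊨𝔅_ : ∀ {n} → Env n → PE n → Set
ρ ⊨𝔅 eqₚ s t  = ⟦ s ⟧ₜ ρ ≡ ⟦ t ⟧ₜ ρ
ρ ⊨𝔅 neqₚ s t = ¬ (⟦ s ⟧ₜ ρ ≡ ⟦ t ⟧ₜ ρ)
ρ ⊨𝔅 andₚ φ ψ = (ρ ⊨𝔅 φ) × (ρ ⊨𝔅 ψ)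
ρ ⊨𝔅 orₚ φ ψ  = (ρ ⊨𝔅 φ) ⊎ (ρ ⊨𝔅 ψ)
ρ ⊨𝔅 exₚ φ    = Σ BitString (λ w → (ρ ,, w) ⊨𝔅 φ)

emptyEnv : Env 0
emptyEnv ()

𝔅⁻⊨_ : PE 0 → Set
𝔅⁻⊨ φ = emptyEnv ⊨𝔅 φ

module Submission where

-- A true purely existential sentence has witnesses in 𝔅⁻; instantiate its
-- quantifiers by the numerals of these witnesses.  The resulting
-- quantifier-free sentence is a true positive combination of closed
-- equations and inequations, so it suffices that B⁻ proves every true
-- closed (in)equation.  Axioms (1) and (2) rewrite every closed term to the
-- numeral of its value, so true equations are provable; axiom (3) strips
-- equal last bits from two distinct numerals until they end in different
-- bits, refuted by (4), or one of them is empty, refuted by (1), (2), (4).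

open import Defs
open import Data.Nat using (ℕ)
open import Data.Fin using (zero; suc)
open import Data.Bool using (Bool; true; false)
open import Data.List using (List; []; _∷_; _++_; reverse)
open import Data.List.Properties using (reverse-++; reverse-injective)
open import Data.List.Relation.Binary.Subset.Propositional using (_⊆_)
import Data.List.Relation.Binary.Subset.Propositional.Properties as ⊆
open import Data.List.Relation.Unary.Any using (here; there)
open import Data.Product using (_,_)
open import Data.Sum using (inj₁; inj₂)
open import Data.Empty using (⊥-elim)
open import Function using (_∘_)
open import Relation.Binary.PropositionalEquality
  using (_≡_; _≢_; refl; sym; trans; cong; cong₂; subst; subst₂)

subT-single-renT : ∀ {n} (u t : Term n) → subT (single u) (renT suc t) ≡ t
subT-single-renT u (var i) = refl
subT-single-renT u `e      = refl
subT-single-renT u `0      = refl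
subT-single-renT u `1      = refl
subT-single-renT u (s ∙ t) = cong₂ _∙_ (subT-single-renT u s) (subT-single-renT u t)

subT-exts-renT : ∀ {m n} (τ : Sub m n) (t : Term m) →
                 subT (exts τ) (renT suc t) ≡ renT suc (subT τ t)
subT-exts-renT τ (var i) = refl
subT-exts-renT τ `e      = refl
subT-exts-renT τ `0      = refl
subT-exts-renT τ `1      = refl
subT-exts-renT τ (s ∙ t) = cong₂ _∙_ (subT-exts-renT τ s) (subT-exts-renT τ t)

module _ {m n k : ℕ} {σ : Sub m n} {τ : Sub n k} {χ : Sub m k} where

  subT-subT : (∀ i → subT τ (σ i) ≡ χ i) → ∀ t → subT τ (subT σ t) ≡ subT χ t
  subT-subT h (var i) = h i
  subT-subT h `e      = refl
  subT-subT h `0      = refl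
  subT-subT h `1      = refl
  subT-subT h (s ∙ t) = cong₂ _∙_ (subT-subT h s) (subT-subT h t)

  exts-subT : (∀ i → subT τ (σ i) ≡ χ i) → ∀ i → subT (exts τ) (exts σ i) ≡ exts χ i
  exts-subT h zero    = refl
  exts-subT h (suc i) = trans (subT-exts-renT τ (σ i)) (cong (renT suc) (h i))

subF-subF : ∀ {m n k} {σ : Sub m n} {τ : Sub n k} {χ : Sub m k} →
            (∀ i → subT τ (σ i) ≡ χ i) → ∀ φ → subF τ (subF σ φ) ≡ subF χ φ
subF-subF h (s ≐ t)  = cong₂ _≐_ (subT-subT h s) (subT-subT h t)
subF-subF h ⊥'       = refl
subF-subF h (φ ⇒ ψ)  = cong₂ _⇒_ (subF-subF h φ) (subF-subF h ψ)
subF-subF h (φ ∧' ψ) = cong₂ _∧'_ (subF-subF h φ) (subF-subF h ψ)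
subF-subF h (φ ∨' ψ) = cong₂ _∨'_ (subF-subF h φ) (subF-subF h ψ)
subF-subF h (∀' φ)   = cong ∀' (subF-subF (exts-subT h) φ)
subF-subF h (∃' φ)   = cong ∃' (subF-subF (exts-subT h) φ)

module _ {n : ℕ} {σ : Sub n n} where

  subT-id : (∀ i → σ i ≡ var i) → ∀ t → subT σ t ≡ t
  subT-id h (var i) = h i
  subT-id h `e      = refl
  subT-id h `0      = refl
  subT-id h `1      = refl
  subT-id h (s ∙ t) = cong₂ _∙_ (subT-id h s) (subT-id h t)

  exts-id : (∀ i → σ i ≡ var i) → ∀ i → exts σ i ≡ var i
  exts-id h zero    = refl
  exts-id h (suc i) = cong (renT suc) (h i)

subF-id : ∀ {n} {σ : Sub n n} → (∀ i → σ i ≡ var i) → ∀ φ → subF σ φ ≡ φ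
subF-id h (s ≐ t)  = cong₂ _≐_ (subT-id h s) (subT-id h t)
subF-id h ⊥'       = refl
subF-id h (φ ⇒ ψ)  = cong₂ _⇒_ (subF-id h φ) (subF-id h ψ)
subF-id h (φ ∧' ψ) = cong₂ _∧'_ (subF-id h φ) (subF-id h ψ)
subF-id h (φ ∨' ψ) = cong₂ _∨'_ (subF-id h φ) (subF-id h ψ)
subF-id h (∀' φ)   = cong ∀' (subF-id (exts-id h) φ)
subF-id h (∃' φ)   = cong ∃' (subF-id (exts-id h) φ)

⊢-weaken : ∀ {n} {Γ Δ : List (Fm n)} {φ} → Γ ⊆ Δ → Γ ⊢ φ → Δ ⊢ φ
⊢-weaken s (hyp p)         = hyp (s p)
⊢-weaken s (⇒I d)          = ⇒I (⊢-weaken (⊆.∷⁺ʳ _ s) d)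
⊢-weaken s (⇒E d e)        = ⇒E (⊢-weaken s d) (⊢-weaken s e)
⊢-weaken s (∧I d e)        = ∧I (⊢-weaken s d) (⊢-weaken s e)
⊢-weaken s (∧E₁ d)         = ∧E₁ (⊢-weaken s d)
⊢-weaken s (∧E₂ d)         = ∧E₂ (⊢-weaken s d)
⊢-weaken s (∨I₁ d)         = ∨I₁ (⊢-weaken s d)
⊢-weaken s (∨I₂ d)         = ∨I₂ (⊢-weaken s d)
⊢-weaken s (∨E d e f)      = ∨E (⊢-weaken s d) (⊢-weaken (⊆.∷⁺ʳ _ s) e) (⊢-weaken (⊆.∷⁺ʳ _ s) f)
⊢-weaken s (⊥E d)          = ⊥E (⊢-weaken s d)
⊢-weaken s (raa d)         = raa (⊢-weaken (⊆.∷⁺ʳ _ s) d)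
⊢-weaken s (∀I d)          = ∀I (⊢-weaken (⊆.map⁺ _ s) d)
⊢-weaken s (∀E d t)        = ∀E (⊢-weaken s d) t
⊢-weaken s (∃I t d)        = ∃I t (⊢-weaken s d)
⊢-weaken s (∃E d e)        = ∃E (⊢-weaken s d) (⊢-weaken (⊆.∷⁺ʳ _ (⊆.map⁺ _ s)) e)
⊢-weaken s ≐refl           = ≐refl
⊢-weaken s (≐subst φ d e)  = ≐subst φ (⊢-weaken s d) (⊢-weaken s e)

module _ {n : ℕ} where

  private
    weaken₁ : ∀ {Γ : List (Fm n)} {ψ φ} → Γ ⊢ φ → (ψ ∷ Γ) ⊢ φ
    weaken₁ = ⊢-weaken there

  ≐-sym : ∀ {Γ : List (Fm n)} {s t} → Γ ⊢ s ≐ t → Γ ⊢ t ≐ s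
  ≐-sym {Γ} {s} {t} p = subst (λ a → Γ ⊢ t ≐ a) (subT-single-renT t s)
    (≐subst (var zero ≐ renT suc s) p
      (subst (λ a → Γ ⊢ s ≐ a) (sym (subT-single-renT s s)) ≐refl))

  ≐-trans : ∀ {Γ : List (Fm n)} {s t u} → Γ ⊢ s ≐ t → Γ ⊢ t ≐ u → Γ ⊢ s ≐ u
  ≐-trans {Γ} {s} {t} {u} p q = subst (λ a → Γ ⊢ a ≐ u) (subT-single-renT u s)
    (≐subst (renT suc s ≐ var zero) q
      (subst (λ a → Γ ⊢ a ≐ t) (sym (subT-single-renT t s)) p))

  ∙-congˡ : ∀ {Γ : List (Fm n)} c {s t} → Γ ⊢ s ≐ t → Γ ⊢ c ∙ s ≐ c ∙ t
  ∙-congˡ {Γ} c {s} {t} p =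
    subst (Γ ⊢_) (cong₂ (λ a b → a ∙ b ≐ a ∙ t) (subT-single-renT t c) (subT-single-renT t s))
      (≐subst (renT suc c ∙ renT suc s ≐ renT suc c ∙ var zero) p
        (subst (Γ ⊢_) (sym (cong₂ (λ a b → a ∙ b ≐ a ∙ s) (subT-single-renT s c) (subT-single-renT s s)))
          ≐refl))

  ∙-congʳ : ∀ {Γ : List (Fm n)} c {s t} → Γ ⊢ s ≐ t → Γ ⊢ s ∙ c ≐ t ∙ c
  ∙-congʳ {Γ} c {s} {t} p =
    subst (Γ ⊢_) (cong₂ (λ a b → b ∙ a ≐ t ∙ a) (subT-single-renT t c) (subT-single-renT t s))
      (≐subst (renT suc s ∙ renT suc c ≐ var zero ∙ renT suc c) p
        (subst (Γ ⊢_) (sym (cong₂ (λ a b → b ∙ a ≐ s ∙ a) (subT-single-renT s c) (subT-single-renT s s)))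
          ≐refl))

  ∙-cong : ∀ {Γ : List (Fm n)} {s t s' t'} → Γ ⊢ s ≐ s' → Γ ⊢ t ≐ t' → Γ ⊢ s ∙ t ≐ s' ∙ t'
  ∙-cong {t = t} {s' = s'} p q = ≐-trans (∙-congʳ t p) (∙-congˡ s' q)

  ≢-sym : ∀ {Γ : List (Fm n)} {s t} → Γ ⊢ ¬' (s ≐ t) → Γ ⊢ ¬' (t ≐ s)
  ≢-sym h = ⇒I (⇒E (weaken₁ h) (≐-sym (hyp (here refl))))

  ≢-resp-≐ : ∀ {Γ : List (Fm n)} {s t s' t'} →
             Γ ⊢ ¬' (s ≐ t) → Γ ⊢ s ≐ s' → Γ ⊢ t ≐ t' → Γ ⊢ ¬' (s' ≐ t')
  ≢-resp-≐ h p q =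
    ⇒I (⇒E (weaken₁ h) (≐-trans (weaken₁ p) (≐-trans (hyp (here refl)) (≐-sym (weaken₁ q)))))

  ∙-cancelˡ-≢ : ∀ {Γ : List (Fm n)} c {s t} → Γ ⊢ ¬' (c ∙ s ≐ c ∙ t) → Γ ⊢ ¬' (s ≐ t)
  ∙-cancelˡ-≢ c h = ⇒I (⇒E (weaken₁ h) (∙-congˡ c (hyp (here refl))))

B⁻-identityˡ : (t : Term 0) → B⁻ ⊢ `e ∙ t ≐ t
B⁻-identityˡ t = ≐-sym (∧E₁ (∀E (hyp (here refl)) t))

B⁻-identityʳ : (t : Term 0) → B⁻ ⊢ t ∙ `e ≐ t
B⁻-identityʳ t = ≐-sym (∧E₂ (∀E (hyp (here refl)) t))

B⁻-assoc : (x y z : Term 0) → B⁻ ⊢ (x ∙ y) ∙ z ≐ x ∙ (y ∙ z)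
B⁻-assoc x y z = subst₂ (λ a b → B⁻ ⊢ (a ∙ b) ∙ z ≐ a ∙ (b ∙ z)) x-eq (subT-single-renT z y)
  (∀E (∀E (∀E (hyp (there (here refl))) x) y) z)
  where
  x-eq : subT (single z) (subT (exts (single y)) (renT suc (renT suc x))) ≡ x
  x-eq = trans (cong (subT (single z)) (subT-exts-renT (single y) (renT suc x)))
           (trans (subT-single-renT z _) (subT-single-renT y x))

B⁻-∙-injective-≢ : (x y : Term 0) →
  B⁻ ⊢ ¬' (x ≐ y) ⇒ (¬' (x ∙ `0 ≐ y ∙ `0) ∧' ¬' (x ∙ `1 ≐ y ∙ `1))
B⁻-∙-injective-≢ x y =
  subst (λ a → B⁻ ⊢ ¬' (a ≐ y) ⇒ (¬' (a ∙ `0 ≐ y ∙ `0) ∧' ¬' (a ∙ `1 ≐ y ∙ `1)))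
    (subT-single-renT y x) (∀E (∀E (hyp (there (there (here refl)))) x) y)

B⁻-∙0≢∙1 : (x y : Term 0) → B⁻ ⊢ ¬' (x ∙ `0 ≐ y ∙ `1)
B⁻-∙0≢∙1 x y = subst (λ a → B⁻ ⊢ ¬' (a ∙ `0 ≐ y ∙ `1)) (subT-single-renT y x)
  (∀E (∀E (hyp (there (there (there (here refl))))) x) y)

bit : Bool → Term 0
bit false = `0
bit true  = `1

-- Axiom (3) compares last bits, so numerals are built by appending bits on
-- the right: numeralʳ w denotes reverse w.
numeralʳ : List Bool → Term 0
numeralʳ []      = `e
numeralʳ (b ∷ w) = numeralʳ w ∙ bit b

numeralʳ-++ : (u v : List Bool) → B⁻ ⊢ numeralʳ v ∙ numeralʳ u ≐ numeralʳ (u ++ v)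
numeralʳ-++ []      v = B⁻-identityʳ (numeralʳ v)
numeralʳ-++ (b ∷ u) v =
  ≐-trans (≐-sym (B⁻-assoc (numeralʳ v) (numeralʳ u) (bit b))) (∙-congʳ (bit b) (numeralʳ-++ u v))

-- e·1 = 1 = 1·e, so e = x0 would give (1x)0 = 1(x0) = 1e = e1, against
-- axiom (4); symmetrically for the last bit 1.
`e≢∙bit : (b : Bool) (x : Term 0) → B⁻ ⊢ ¬' (`e ≐ x ∙ bit b)
`e≢∙bit false x = ≢-sym (∙-cancelˡ-≢ `1
  (≢-resp-≐ (B⁻-∙0≢∙1 (`1 ∙ x) `e) (B⁻-assoc `1 x `0)
    (≐-trans (B⁻-identityˡ `1) (≐-sym (B⁻-identityʳ `1)))))
`e≢∙bit true  x = ∙-cancelˡ-≢ `0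
  (≢-resp-≐ (B⁻-∙0≢∙1 `e (`0 ∙ x)) (≐-trans (B⁻-identityˡ `0) (≐-sym (B⁻-identityʳ `0)))
    (B⁻-assoc `0 x `1))

numeralʳ-≢ : (u v : List Bool) → u ≢ v → B⁻ ⊢ ¬' (numeralʳ u ≐ numeralʳ v)
numeralʳ-≢ []          []          u≢v = ⊥-elim (u≢v refl)
numeralʳ-≢ []          (c ∷ v)     u≢v = `e≢∙bit c (numeralʳ v)
numeralʳ-≢ (b ∷ u)     []          u≢v = ≢-sym (`e≢∙bit b (numeralʳ u))
numeralʳ-≢ (false ∷ u) (false ∷ v) u≢v =
  ∧E₁ (⇒E (B⁻-∙-injective-≢ _ _) (numeralʳ-≢ u v (u≢v ∘ cong (false ∷_))))
numeralʳ-≢ (true ∷ u)  (true ∷ v)  u≢v =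
  ∧E₂ (⇒E (B⁻-∙-injective-≢ _ _) (numeralʳ-≢ u v (u≢v ∘ cong (true ∷_))))
numeralʳ-≢ (false ∷ u) (true ∷ v)  u≢v = B⁻-∙0≢∙1 (numeralʳ u) (numeralʳ v)
numeralʳ-≢ (true ∷ u)  (false ∷ v) u≢v = ≢-sym (B⁻-∙0≢∙1 (numeralʳ v) (numeralʳ u))

numeral : BitString → Term 0
numeral w = numeralʳ (reverse w)

numeral-++ : (u v : BitString) → B⁻ ⊢ numeral u ∙ numeral v ≐ numeral (u ++ v)
numeral-++ u v = subst (λ w → B⁻ ⊢ numeral u ∙ numeral v ≐ numeralʳ w) (sym (reverse-++ u v))
  (numeralʳ-++ (reverse v) (reverse u))

numeral-≢ : (u v : BitString) → u ≢ v → B⁻ ⊢ ¬' (numeral u ≐ numeral v)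
numeral-≢ u v u≢v = numeralʳ-≢ (reverse u) (reverse v) (u≢v ∘ reverse-injective)

numerals : ∀ {n} → Env n → Sub n 0
numerals ρ i = numeral (ρ i)

numerals-,, : ∀ {n} (ρ : Env n) (w : BitString) →
              ∀ i → subT (single (numeral w)) (exts (numerals ρ) i) ≡ numerals (ρ ,, w) i
numerals-,, ρ w zero    = refl
numerals-,, ρ w (suc i) = subT-single-renT _ _

B⁻⊢subT-numerals≐numeral : ∀ {n} (t : Term n) (ρ : Env n) →
                           B⁻ ⊢ subT (numerals ρ) t ≐ numeral (⟦ t ⟧ₜ ρ)
B⁻⊢subT-numerals≐numeral (var i) ρ = ≐refl
B⁻⊢subT-numerals≐numeral `e      ρ = ≐refl
B⁻⊢subT-numerals≐numeral `0      ρ = ≐-sym (B⁻-identityˡ `0)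
B⁻⊢subT-numerals≐numeral `1      ρ = ≐-sym (B⁻-identityˡ `1)
B⁻⊢subT-numerals≐numeral (s ∙ t) ρ =
  ≐-trans (∙-cong (B⁻⊢subT-numerals≐numeral s ρ) (B⁻⊢subT-numerals≐numeral t ρ))
    (numeral-++ (⟦ s ⟧ₜ ρ) (⟦ t ⟧ₜ ρ))

⊨𝔅⇒B⁻⊢subF-numerals : ∀ {n} (φ : PE n) (ρ : Env n) → ρ ⊨𝔅 φ → B⁻ ⊢ subF (numerals ρ) ⌜ φ ⌝
⊨𝔅⇒B⁻⊢subF-numerals (eqₚ s t) ρ s≡t =
  ≐-trans (B⁻⊢subT-numerals≐numeral s ρ)
    (subst (λ w → B⁻ ⊢ numeral w ≐ subT (numerals ρ) t) (sym s≡t)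
      (≐-sym (B⁻⊢subT-numerals≐numeral t ρ)))
⊨𝔅⇒B⁻⊢subF-numerals (neqₚ s t) ρ s≢t =
  ≢-resp-≐ (numeral-≢ _ _ s≢t)
    (≐-sym (B⁻⊢subT-numerals≐numeral s ρ)) (≐-sym (B⁻⊢subT-numerals≐numeral t ρ))
⊨𝔅⇒B⁻⊢subF-numerals (andₚ φ ψ) ρ (⊨φ , ⊨ψ) =
  ∧I (⊨𝔅⇒B⁻⊢subF-numerals φ ρ ⊨φ) (⊨𝔅⇒B⁻⊢subF-numerals ψ ρ ⊨ψ)
⊨𝔅⇒B⁻⊢subF-numerals (orₚ φ ψ) ρ (inj₁ ⊨φ) = ∨I₁ (⊨𝔅⇒B⁻⊢subF-numerals φ ρ ⊨φ)
⊨𝔅⇒B⁻⊢subF-numerals (orₚ φ ψ) ρ (inj₂ ⊨ψ) = ∨I₂ (⊨𝔅⇒B⁻⊢subF-numerals ψ ρ ⊨ψ)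
⊨𝔅⇒B⁻⊢subF-numerals (exₚ φ) ρ (w , ⊨φ) =
  ∃I (numeral w)
    (subst (B⁻ ⊢_) (sym (subF-subF (numerals-,, ρ w) ⌜ φ ⌝))
      (⊨𝔅⇒B⁻⊢subF-numerals φ (ρ ,, w) ⊨φ))

theorem3 : (φ : PE 0) → 𝔅⁻⊨ φ → B⁻ ⊢ ⌜ φ ⌝
theorem3 φ ⊨φ =
  subst (B⁻ ⊢_) (subF-id (λ ()) ⌜ φ ⌝) (⊨𝔅⇒B⁻⊢subF-numerals φ emptyEnv ⊨φ)
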